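{- Let $n\geq 2$ and $v\geq 2$ be integers. Then the graph $\Gamma(n,v)$ defined below is a Cayley graph of the cyclic group of order $nv$ (i.e. it is a circulant graph).
   Context: The graph $\Gamma(n,v)$ has vertex set $\{(i,j):0\leq i\leq n-1,\ 0\leq j\leq v-1\}$, and $(i,j)$ is adjacent to $(k,\ell)$ if and only if one of the following holds: (1) $i=k$ and $j\neq \ell$; (2) $i<k$ and $\ell-j\not\equiv 0$ and $\ell-j\not\equiv 1 \pmod v$; (3) $i>k$ and $j-\ell\not\equiv 0$ and $j-\ell\not\equiv 1\pmod v$. A Cayley graph $\mathrm{Cay}(H,S)$ of a group $H$ with inverse-closed $S\subseteq H\setminus\{1\}$ has vertex set $H$ and edges $\{g,gs\}$ for $g\in H$, $s\in S$. -}

module Defs where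

open import Data.Nat using (ℕ; zero; suc; _+_; _∸_; _<_; _%_)
open import Data.Nat.DivMod using (m%n<n)
open import Data.Fin using (Fin; toℕ; fromℕ<)
open import Data.Fin.Subset using (Subset; _∈_; _∉_)
open import Data.Product using (_×_; _,_; ∃-syntax)
open import Data.Sum using (_⊎_)
open import Relation.Binary.PropositionalEquality using (_≡_; _≢_)

-- Residue of (b - a) modulo v, for a b : Fin v (computed as (v + b - a) mod v).
-- For v = 0 there are no such a, b; the value is then irrelevant.
diffMod : ∀ {v} → Fin v → Fin v → ℕ
diffMod {zero}  a b = 0
diffMod {suc m} a b = (suc m + toℕ b ∸ toℕ a) % suc m

ΓAdj : (n v : ℕ) → (Fin n × Fin v) → (Fin n × Fin v) → Set
ΓAdj n v (i , j) (k , ℓ) =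
    (i ≡ k × j ≢ ℓ)
  ⊎ ((toℕ i < toℕ k) × (diffMod j ℓ ≢ 0) × (diffMod j ℓ ≢ 1))
  ⊎ ((toℕ k < toℕ i) × (diffMod ℓ j ≢ 0) × (diffMod ℓ j ≢ 1))

addMod : ∀ {N} → Fin N → Fin N → Fin N
addMod {suc m} a b = fromℕ< (m%n<n (toℕ a + toℕ b) (suc m))

IsConnectionSet : ∀ {N} → Subset N → Set
IsConnectionSet {N} S =
    (∀ (s : Fin N) → s ∈ S → toℕ s ≢ 0)
  × (∀ (s t : Fin N) → s ∈ S → toℕ (addMod s t) ≡ 0 → t ∈ S)

CayAdj : ∀ {N} → Subset N → Fin N → Fin N → Set
CayAdj {N} S g h = ∃[ s ] (s ∈ S × h ≡ addMod g s)

-- Number the vertex (i , j) of Γ(n,v) by n·j + (n − 1 − i). Adding 1 modulo nv then acts on vertices as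
-- `rotate`: a row i > 0 moves to row i − 1, and row 0 becomes row n − 1 with every column j moved to j + 1.
-- This preserves adjacency: inside the rows i > 0 nothing changes, and when a vertex leaves row 0 the row order
-- of the pair flips while the condition ℓ − j ∉ {0, 1} turns into (j + 1) − ℓ ∉ {0, 1}, which is the same.
-- A symmetric irreflexive relation on ℤ/N that is invariant under x ↦ x + 1 is invariant under every
-- translation, so it is the Cayley graph of the set of neighbours of 0.
module Submission where

open import Defs
open import Data.Nat
  using (ℕ; zero; suc; _+_; _∸_; _*_; _<_; _≤_; _%_; NonZero; z≤n; s≤s; z<s; s<s; s<s⁻¹)
open import Data.Nat.Divisibility using (∣-refl)
open import Data.Nat.Properties
open import Data.Nat.DivMod
open import Data.Fin using (Fin; zero; suc; toℕ; fromℕ; inject₁; opposite; combine; remQuot; cast)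
open import Data.Fin.Properties
  using (toℕ-injective; toℕ<n; toℕ-fromℕ; toℕ-fromℕ<; toℕ-inject₁; toℕ-cast; toℕ-combine;
         cast-involutive; remQuot-combine; opposite-prop; inject₁ℕ<; combine-remQuot; opposite-involutive)
  renaming (suc-injective to Fin-suc-injective)
open import Data.Fin.Subset using (Subset; _∈_)
open import Data.Vec using (tabulate)
open import Data.Vec.Properties using (lookup∘tabulate; []=⇒lookup; lookup⇒[]=)
open import Data.Product using (_×_; _,_; proj₁; proj₂; map₁; swap; uncurry; Σ-syntax; ∃-syntax)
open import Data.Sum using (inj₁; inj₂)
open import Function using (_∘_)
open import Function.Bundles using (Bijection; Equivalence; Inverse; _↔_; _⤖_; _⇔_; mk⇔; mk↔ₛ′)
open import Function.Properties.Inverse using (↔⇒⤖)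
open import Function.Construct.Composition using (_⇔-∘_)
open import Level using (0ℓ)
open import Relation.Binary using (Rel; Symmetric; Irreflexive; Decidable)
open import Relation.Binary.PropositionalEquality
open import Relation.Nullary using (Dec; yes; no; does; ¬?; _×-dec_; _⊎-dec_)
open import Relation.Nullary.Decidable using (dec-true)
open import Relation.Unary as Pred using (Pred)
import Data.Fin as Fin
import Data.Nat as ℕ

open ≡-Reasoning

[m+n%d]%d≡[m+n]%d : ∀ m n d .{{_ : NonZero d}} → (m + n % d) % d ≡ (m + n) % d
[m+n%d]%d≡[m+n]%d m n d = begin
  (m + n % d) % d          ≡⟨ %-distribˡ-+ m (n % d) d ⟩
  (m % d + n % d % d) % d  ≡⟨ cong (λ k → (m % d + k) % d) (m%n%n≡m%n n d) ⟩
  (m % d + n % d) % d      ≡⟨ %-distribˡ-+ m n d ⟨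
  (m + n) % d              ∎

[m%d+n]%d≡[m+n]%d : ∀ m n d .{{_ : NonZero d}} → (m % d + n) % d ≡ (m + n) % d
[m%d+n]%d≡[m+n]%d m n d = begin
  (m % d + n) % d  ≡⟨ cong (_% d) (+-comm (m % d) n) ⟩
  (n + m % d) % d  ≡⟨ [m+n%d]%d≡[m+n]%d n m d ⟩
  (n + m) % d      ≡⟨ cong (_% d) (+-comm n m) ⟩
  (m + n) % d      ∎

-- addMod g s is definitionally g ⊕ toℕ s.
infixl 6 _⊕_

_⊕_ : ∀ {m} → Fin (suc m) → ℕ → Fin (suc m)
_⊕_ {m} x t = (toℕ x + t) mod suc m

module _ {m : ℕ} where

  private
    N : ℕ
    N = suc m

  toℕ-⊕ : ∀ (x : Fin N) t → toℕ (x ⊕ t) ≡ (toℕ x + t) % N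
  toℕ-⊕ x t = toℕ-fromℕ< _

  toℕ-⊕-< : ∀ (x : Fin N) t → toℕ x + t < N → toℕ (x ⊕ t) ≡ toℕ x + t
  toℕ-⊕-< x t lt = trans (toℕ-⊕ x t) (m<n⇒m%n≡m lt)

  ⊕-identityʳ : ∀ (x : Fin N) → x ⊕ 0 ≡ x
  ⊕-identityʳ x =
    toℕ-injective (trans (toℕ-⊕ x 0) (trans (cong (_% N) (+-identityʳ (toℕ x))) (m<n⇒m%n≡m (toℕ<n x))))

  ⊕-period : ∀ (x : Fin N) → x ⊕ N ≡ x
  ⊕-period x =
    toℕ-injective (trans (toℕ-⊕ x N) (trans ([m+n]%n≡m%n (toℕ x) N) (m<n⇒m%n≡m (toℕ<n x))))

  ⊕-assoc : ∀ (x : Fin N) a b → x ⊕ a ⊕ b ≡ x ⊕ (a + b)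
  ⊕-assoc x a b = toℕ-injective (begin
    toℕ (x ⊕ a ⊕ b)            ≡⟨ toℕ-⊕ (x ⊕ a) b ⟩
    (toℕ (x ⊕ a) + b) % N      ≡⟨ cong (λ k → (k + b) % N) (toℕ-⊕ x a) ⟩
    ((toℕ x + a) % N + b) % N  ≡⟨ [m%d+n]%d≡[m+n]%d (toℕ x + a) b N ⟩
    (toℕ x + a + b) % N        ≡⟨ cong (_% N) (+-assoc (toℕ x) a b) ⟩
    (toℕ x + (a + b)) % N      ≡⟨ toℕ-⊕ x (a + b) ⟨
    toℕ (x ⊕ (a + b))          ∎)

  ⊕-comm : ∀ (x y : Fin N) → x ⊕ toℕ y ≡ y ⊕ toℕ x
  ⊕-comm x y = cong (_mod N) (+-comm (toℕ x) (toℕ y))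

  zero-⊕ : ∀ (x : Fin N) → zero ⊕ toℕ x ≡ x
  zero-⊕ x = trans (⊕-comm zero x) (⊕-identityʳ x)

  ⊕-inverse : ∀ (x : Fin N) → x ⊕ (N ∸ toℕ x) ≡ zero
  ⊕-inverse x =
    toℕ-injective (trans (toℕ-⊕ x _) (trans (cong (_% N) (m+[n∸m]≡n (<⇒≤ (toℕ<n x)))) (n%n≡0 N)))

  ⊕-undo : ∀ (x : Fin N) {a b} → a + b ≡ N → x ⊕ a ⊕ b ≡ x
  ⊕-undo x {a} {b} a+b≡N = trans (⊕-assoc x a b) (trans (cong (x ⊕_) a+b≡N) (⊕-period x))

  ⊕-cancelʳ : ∀ {x y : Fin N} {t} → t ≤ N → x ⊕ t ≡ y ⊕ t → x ≡ y
  ⊕-cancelʳ {x} {y} {t} t≤N e = begin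
    x                  ≡⟨ ⊕-undo x (m+[n∸m]≡n t≤N) ⟨
    x ⊕ t ⊕ (N ∸ t)    ≡⟨ cong (_⊕ (N ∸ t)) e ⟩
    y ⊕ t ⊕ (N ∸ t)    ≡⟨ ⊕-undo y (m+[n∸m]≡n t≤N) ⟩
    y                  ∎

module _ {n} {P : Pred (Fin n) 0ℓ} (P? : Pred.Decidable P) where

  ∈-tabulate-does : ∀ {x} → x ∈ tabulate (does ∘ P?) ⇔ P x
  ∈-tabulate-does {x} =
    mk⇔ to (λ px → lookup⇒[]= x _ (trans (lookup∘tabulate _ x) (dec-true (P? x) px)))
    where
    to : x ∈ tabulate (does ∘ P?) → P x
    to x∈ with P? x | trans (sym (lookup∘tabulate (does ∘ P?) x)) ([]=⇒lookup x∈)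
    ... | yes px | _  = px
    ... | no _   | ()

module _ {m : ℕ} (R : Rel (Fin (suc m)) 0ℓ) (R-rotate : ∀ {x y} → R x y → R (x ⊕ 1) (y ⊕ 1)) where

  R-translate : ∀ t {x y} → R x y → R (x ⊕ t) (y ⊕ t)
  R-translate zero    {x} {y} r = subst₂ R (sym (⊕-identityʳ x)) (sym (⊕-identityʳ y)) r
  R-translate (suc t) {x} {y} r = subst₂ R (⊕-assoc x 1 t) (⊕-assoc y 1 t) (R-translate t (R-rotate r))

  rotation-invariant⇒circulant : Decidable R → Symmetric R → Irreflexive _≡_ R →
    ∃[ S ] (IsConnectionSet S × ∀ g h → R g h ⇔ CayAdj S g h)
  rotation-invariant⇒circulant R? R-sym R-irrefl =
    S , (S-nonzero , S-inverse-closed) , λ g h → mk⇔ (R⇒Cay g h) (Cay⇒R g h)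
    where
    N : ℕ
    N = suc m

    S : Subset N
    S = tabulate (does ∘ R? zero)

    ∈S⇔ : ∀ {s} → s ∈ S ⇔ R zero s
    ∈S⇔ = ∈-tabulate-does (R? zero)

    R-from-zero : ∀ {s} g → R zero s → R g (addMod g s)
    R-from-zero {s} g r = subst₂ R (zero-⊕ g) (⊕-comm s g) (R-translate (toℕ g) r)

    R⇒Cay : ∀ g h → R g h → CayAdj S g h
    R⇒Cay g h r = h ⊕ (N ∸ toℕ g) , Equivalence.from ∈S⇔ r₀ , sym g+s≡h
      where
      r₀ : R zero (h ⊕ (N ∸ toℕ g))
      r₀ = subst (λ z → R z (h ⊕ (N ∸ toℕ g))) (⊕-inverse g) (R-translate (N ∸ toℕ g) r)
      g+s≡h : addMod g (h ⊕ (N ∸ toℕ g)) ≡ h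
      g+s≡h = trans (⊕-comm g _) (⊕-undo h (m∸n+n≡m (<⇒≤ (toℕ<n g))))

    Cay⇒R : ∀ g h → CayAdj S g h → R g h
    Cay⇒R g h (s , s∈S , h≡g+s) = subst (R g) (sym h≡g+s) (R-from-zero g (Equivalence.to ∈S⇔ s∈S))

    S-nonzero : ∀ s → s ∈ S → toℕ s ≢ 0
    S-nonzero s s∈S s≡0 = R-irrefl (toℕ-injective (sym s≡0)) (Equivalence.to ∈S⇔ s∈S)

    S-inverse-closed : ∀ s t → s ∈ S → toℕ (addMod s t) ≡ 0 → t ∈ S
    S-inverse-closed s t s∈S s+t≡0 =
      Equivalence.from ∈S⇔ (R-sym (subst (R t) t+s≡0 (R-from-zero t (Equivalence.to ∈S⇔ s∈S))))
      where
      t+s≡0 : addMod t s ≡ zero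
      t+s≡0 = trans (⊕-comm t s) (toℕ-injective s+t≡0)

module _ {X : Set} {m : ℕ} (φ : X ↔ Fin (suc m)) (R : Rel X 0ℓ) where

  open Inverse φ using (to; from; strictlyInverseˡ; strictlyInverseʳ)

  rotation-automorphism⇒circulant :
    Decidable R → Symmetric R → Irreflexive _≡_ R →
    (ρ : X → X) → (∀ x → to (ρ x) ≡ to x ⊕ 1) → (∀ {x y} → R x y → R (ρ x) (ρ y)) →
    ∃[ S ] (IsConnectionSet S × ∀ x y → R x y ⇔ CayAdj S (to x) (to y))
  rotation-automorphism⇒circulant R? R-sym R-irrefl ρ to-ρ R-ρ =
    pull-back (rotation-invariant⇒circulant R′ R′-rotate
                 (λ g h → R? (from g) (from h)) R-sym (R-irrefl ∘ cong from))
    where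
    R′ : Rel (Fin (suc m)) 0ℓ
    R′ g h = R (from g) (from h)

    from-⊕1 : ∀ g → from (g ⊕ 1) ≡ ρ (from g)
    from-⊕1 g = begin
      from (g ⊕ 1)              ≡⟨ cong (λ y → from (y ⊕ 1)) (strictlyInverseˡ g) ⟨
      from (to (from g) ⊕ 1)    ≡⟨ cong from (to-ρ (from g)) ⟨
      from (to (ρ (from g)))    ≡⟨ strictlyInverseʳ (ρ (from g)) ⟩
      ρ (from g)                ∎

    R′-rotate : ∀ {g h} → R′ g h → R′ (g ⊕ 1) (h ⊕ 1)
    R′-rotate {g} {h} r = subst₂ R (sym (from-⊕1 g)) (sym (from-⊕1 h)) (R-ρ r)

    R⇔R′ : ∀ x y → R x y ⇔ R′ (to x) (to y)
    R⇔R′ x y = mk⇔ (subst₂ R (sym (strictlyInverseʳ x)) (sym (strictlyInverseʳ y)))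
                   (subst₂ R (strictlyInverseʳ x) (strictlyInverseʳ y))

    pull-back : ∃[ S ] (IsConnectionSet S × ∀ g h → R′ g h ⇔ CayAdj S g h) →
                ∃[ S ] (IsConnectionSet S × ∀ x y → R x y ⇔ CayAdj S (to x) (to y))
    pull-back (S , S-conn , R′⇔Cay) = S , S-conn , λ x y → R′⇔Cay (to x) (to y) ⇔-∘ R⇔R′ x y

module _ {m : ℕ} where

  private
    V : ℕ
    V = suc m

  ⊕-diffMod : ∀ (j ℓ : Fin V) → j ⊕ diffMod j ℓ ≡ ℓ
  ⊕-diffMod j ℓ = toℕ-injective (begin
    toℕ (j ⊕ diffMod j ℓ)                      ≡⟨ toℕ-⊕ j _ ⟩
    (toℕ j + (V + toℕ ℓ ∸ toℕ j) % V) % V      ≡⟨ [m+n%d]%d≡[m+n]%d (toℕ j) _ V ⟩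
    (toℕ j + (V + toℕ ℓ ∸ toℕ j)) % V          ≡⟨ cong (_% V) (m+[n∸m]≡n j≤V+ℓ) ⟩
    (V + toℕ ℓ) % V                            ≡⟨ %-remove-+ˡ (toℕ ℓ) (∣-refl {V}) ⟩
    toℕ ℓ % V                                  ≡⟨ m<n⇒m%n≡m (toℕ<n ℓ) ⟩
    toℕ ℓ                                      ∎)
    where
    j≤V+ℓ : toℕ j ≤ V + toℕ ℓ
    j≤V+ℓ = ≤-trans (<⇒≤ (toℕ<n j)) (m≤m+n V (toℕ ℓ))

  diffMod-⊕ : ∀ (j : Fin V) t → diffMod j (j ⊕ t) ≡ t % V
  diffMod-⊕ j t = begin
    (V + toℕ (j ⊕ t) ∸ toℕ j) % V      ≡⟨ cong (λ k → (V + k ∸ toℕ j) % V) (toℕ-⊕ j t) ⟩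
    (V + (toℕ j + t) % V ∸ toℕ j) % V  ≡⟨ cong (_% V) (+-∸-comm _ j≤V) ⟩
    (V ∸ toℕ j + (toℕ j + t) % V) % V  ≡⟨ [m+n%d]%d≡[m+n]%d (V ∸ toℕ j) _ V ⟩
    (V ∸ toℕ j + (toℕ j + t)) % V      ≡⟨ cong (_% V) (+-assoc (V ∸ toℕ j) (toℕ j) t) ⟨
    (V ∸ toℕ j + toℕ j + t) % V        ≡⟨ cong (λ k → (k + t) % V) (m∸n+n≡m j≤V) ⟩
    (V + t) % V                        ≡⟨ %-remove-+ˡ t (∣-refl {V}) ⟩
    t % V                              ∎
    where
    j≤V : toℕ j ≤ V
    j≤V = <⇒≤ (toℕ<n j)

  diffMod≡⇔ : ∀ (j ℓ : Fin V) {t} → t < V → diffMod j ℓ ≡ t ⇔ ℓ ≡ j ⊕ t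
  diffMod≡⇔ j ℓ {t} t<V = mk⇔
    (λ d≡t → trans (sym (⊕-diffMod j ℓ)) (cong (j ⊕_) d≡t))
    (λ ℓ≡j+t → trans (cong (diffMod j) ℓ≡j+t) (trans (diffMod-⊕ j t) (m<n⇒m%n≡m t<V)))

diffMod≡0⇔ : ∀ {m} (j ℓ : Fin (suc m)) → diffMod j ℓ ≡ 0 ⇔ ℓ ≡ j
diffMod≡0⇔ j ℓ = mk⇔
  (λ d≡0 → trans (Equivalence.to (diffMod≡⇔ j ℓ z<s) d≡0) (⊕-identityʳ j))
  (λ ℓ≡j → Equivalence.from (diffMod≡⇔ j ℓ z<s) (trans ℓ≡j (sym (⊕-identityʳ j))))

diffMod≡1⇔ : ∀ {m} (j ℓ : Fin (suc (suc m))) → diffMod j ℓ ≡ 1 ⇔ ℓ ≡ j ⊕ 1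
diffMod≡1⇔ j ℓ = diffMod≡⇔ j ℓ (s<s z<s)

Apart : ∀ {v} → Fin v → Fin v → Set
Apart j ℓ = diffMod j ℓ ≢ 0 × diffMod j ℓ ≢ 1

Apart-rotate : ∀ {m} (j ℓ : Fin (suc (suc m))) → Apart j ℓ → Apart ℓ (j ⊕ 1)
Apart-rotate j ℓ (d≢0 , d≢1) = d′≢0 , d′≢1
  where
  d′≢0 : diffMod ℓ (j ⊕ 1) ≢ 0
  d′≢0 d≡0 = d≢1 (Equivalence.from (diffMod≡1⇔ j ℓ)
                    (sym (Equivalence.to (diffMod≡0⇔ ℓ (j ⊕ 1)) d≡0)))
  d′≢1 : diffMod ℓ (j ⊕ 1) ≢ 1
  d′≢1 d≡1 = d≢0 (Equivalence.from (diffMod≡0⇔ j ℓ)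
                    (sym (⊕-cancelʳ (s≤s z≤n) (Equivalence.to (diffMod≡1⇔ ℓ (j ⊕ 1)) d≡1))))

module _ {n v : ℕ} where

  Γ-sym : Symmetric (ΓAdj n v)
  Γ-sym (inj₁ (i≡k , j≢ℓ)) = inj₁ (sym i≡k , j≢ℓ ∘ sym)
  Γ-sym (inj₂ (inj₁ below)) = inj₂ (inj₂ below)
  Γ-sym (inj₂ (inj₂ above)) = inj₂ (inj₁ above)

  Γ-irrefl : Irreflexive _≡_ (ΓAdj n v)
  Γ-irrefl refl (inj₁ (_ , j≢j))         = j≢j refl
  Γ-irrefl refl (inj₂ (inj₁ (i<i , _))) = <-irrefl refl i<i
  Γ-irrefl refl (inj₂ (inj₂ (i<i , _))) = <-irrefl refl i<i

  ΓAdj? : Decidable (ΓAdj n v)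
  ΓAdj? (i , j) (k , ℓ) =
    (i Fin.≟ k ×-dec ¬? (j Fin.≟ ℓ))
    ⊎-dec (toℕ i ℕ.<? toℕ k ×-dec Apart? j ℓ)
    ⊎-dec (toℕ k ℕ.<? toℕ i ×-dec Apart? ℓ j)
    where
    Apart? : ∀ (a b : Fin v) → Dec (Apart a b)
    Apart? a b = ¬? (diffMod a b ℕ.≟ 0) ×-dec ¬? (diffMod a b ℕ.≟ 1)

toℕ-opposite-fromℕ : ∀ k → toℕ (opposite (fromℕ k)) ≡ 0
toℕ-opposite-fromℕ k =
  trans (opposite-prop (fromℕ k)) (trans (cong (k ∸_) (toℕ-fromℕ k)) (n∸n≡0 k))

toℕ-opposite-inject₁ : ∀ {k} (i : Fin k) →
                       toℕ (opposite (inject₁ i)) ≡ suc (toℕ (opposite (suc i)))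
toℕ-opposite-inject₁ {suc k} zero = begin
  toℕ (fromℕ (suc k))          ≡⟨ toℕ-fromℕ (suc k) ⟩
  suc k                        ≡⟨ cong suc (toℕ-fromℕ k) ⟨
  suc (toℕ (fromℕ k))          ≡⟨ cong suc (toℕ-inject₁ (fromℕ k)) ⟨
  suc (toℕ (inject₁ (fromℕ k))) ∎
toℕ-opposite-inject₁ {suc k} (suc i) = begin
  toℕ (inject₁ (opposite (inject₁ i)))   ≡⟨ toℕ-inject₁ (opposite (inject₁ i)) ⟩
  toℕ (opposite (inject₁ i))             ≡⟨ toℕ-opposite-inject₁ i ⟩
  suc (toℕ (opposite (suc i)))           ≡⟨ cong suc (toℕ-inject₁ (opposite (suc i))) ⟨
  suc (toℕ (inject₁ (opposite (suc i)))) ∎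

inject₁<fromℕ : ∀ {k} (i : Fin k) → toℕ (inject₁ i) < toℕ (fromℕ k)
inject₁<fromℕ {k} i = subst (toℕ (inject₁ i) <_) (sym (toℕ-fromℕ k)) (inject₁ℕ< i)

inject₁-mono-< : ∀ {k} {i j : Fin k} → toℕ i < toℕ j → toℕ (inject₁ i) < toℕ (inject₁ j)
inject₁-mono-< {i = i} {j} = subst₂ _<_ (sym (toℕ-inject₁ i)) (sym (toℕ-inject₁ j))

module _ {n₁ v₁ : ℕ} where

  private
    n v : ℕ
    n = suc n₁
    v = suc v₁

  position : Fin n × Fin v → Fin (n * v)
  position (i , j) = cast (*-comm v n) (combine j (opposite i))

  unposition : Fin (n * v) → Fin n × Fin v
  unposition = map₁ opposite ∘ swap ∘ remQuot {v} n ∘ cast (*-comm n v)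

  position↔ : (Fin n × Fin v) ↔ Fin (n * v)
  position↔ = mk↔ₛ′ position unposition position-unposition unposition-position
    where
    position-unposition : ∀ x → position (unposition x) ≡ x
    position-unposition x = begin
      cast (*-comm v n) (combine (proj₁ c) (opposite (opposite (proj₂ c))))
        ≡⟨ cong (cast (*-comm v n) ∘ combine (proj₁ c)) (opposite-involutive (proj₂ c)) ⟩
      cast (*-comm v n) (uncurry combine c)
        ≡⟨ cong (cast (*-comm v n)) (combine-remQuot {v} n (cast (*-comm n v) x)) ⟩
      cast (*-comm v n) (cast (*-comm n v) x)
        ≡⟨ cast-involutive (*-comm v n) (*-comm n v) x ⟩
      x ∎
      where c = remQuot {v} n (cast (*-comm n v) x)

    unposition-position : ∀ p → unposition (position p) ≡ p
    unposition-position (i , j) = begin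
      map₁ opposite (swap (remQuot n (cast (*-comm n v) (cast (*-comm v n) (combine j (opposite i))))))
        ≡⟨ cong (map₁ opposite ∘ swap ∘ remQuot {v} n)
                (cast-involutive (*-comm n v) (*-comm v n) (combine j (opposite i))) ⟩
      map₁ opposite (swap (remQuot n (combine j (opposite i))))
        ≡⟨ cong (map₁ opposite ∘ swap) (remQuot-combine j (opposite i)) ⟩
      opposite (opposite i) , j
        ≡⟨ cong (_, j) (opposite-involutive i) ⟩
      i , j ∎

  rotate : Fin n × Fin v → Fin n × Fin v
  rotate (zero  , j) = fromℕ n₁ , j ⊕ 1
  rotate (suc i , j) = inject₁ i , j

  toℕ-position : ∀ i j → toℕ (position (i , j)) ≡ n * toℕ j + toℕ (opposite i)
  toℕ-position i j = trans (toℕ-cast (*-comm v n) (combine j (opposite i))) (toℕ-combine j (opposite i))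

  position-rotate : ∀ p → position (rotate p) ≡ position p ⊕ 1
  position-rotate (zero , j) = toℕ-injective (begin
    toℕ (position (fromℕ n₁ , j ⊕ 1))
      ≡⟨ toℕ-position (fromℕ n₁) (j ⊕ 1) ⟩
    n * toℕ (j ⊕ 1) + toℕ (opposite (fromℕ n₁))
      ≡⟨ cong₂ (λ a b → n * a + b) (toℕ-⊕ j 1) (toℕ-opposite-fromℕ n₁) ⟩
    n * ((toℕ j + 1) % v) + 0
      ≡⟨ trans (+-identityʳ _) (*-comm n _) ⟩
    (toℕ j + 1) % v * n
      ≡⟨ m%n*o≡m*o%[n*o] (toℕ j + 1) v n ⟩
    (toℕ j + 1) * n % (v * n)
      ≡⟨ %-congʳ {o = (toℕ j + 1) * n} (*-comm v n) ⟩
    (toℕ j + 1) * n % (n * v)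
      ≡⟨ cong (_% (n * v)) (last-row-step (toℕ j)) ⟩
    (n * toℕ j + n₁ + 1) % (n * v)
      ≡⟨ cong (λ a → (n * toℕ j + a + 1) % (n * v)) (toℕ-fromℕ n₁) ⟨
    (n * toℕ j + toℕ (opposite {n} zero) + 1) % (n * v)
      ≡⟨ cong (λ a → (a + 1) % (n * v)) (toℕ-position zero j) ⟨
    (toℕ (position (zero , j)) + 1) % (n * v)
      ≡⟨ toℕ-⊕ (position (zero , j)) 1 ⟨
    toℕ (position (zero , j) ⊕ 1) ∎)
    where
    last-row-step : ∀ a → (a + 1) * n ≡ n * a + n₁ + 1
    last-row-step a = begin
      (a + 1) * n      ≡⟨ *-comm (a + 1) n ⟩
      n * (a + 1)      ≡⟨ *-distribˡ-+ n a 1 ⟩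
      n * a + n * 1    ≡⟨ cong (λ b → n * a + b) (trans (*-identityʳ n) (+-comm 1 n₁)) ⟩
      n * a + (n₁ + 1) ≡⟨ +-assoc (n * a) n₁ 1 ⟨
      n * a + n₁ + 1   ∎
  position-rotate (suc i , j) = toℕ-injective (begin
    toℕ (position (inject₁ i , j))
      ≡⟨ next-row ⟩
    toℕ (position (suc i , j)) + 1
      ≡⟨ toℕ-⊕-< (position (suc i , j)) 1 (subst (_< n * v) next-row (toℕ<n _)) ⟨
    toℕ (position (suc i , j) ⊕ 1) ∎)
    where
    next-row : toℕ (position (inject₁ i , j)) ≡ toℕ (position (suc i , j)) + 1
    next-row = begin
      toℕ (position (inject₁ i , j))            ≡⟨ toℕ-position (inject₁ i) j ⟩
      n * toℕ j + toℕ (opposite (inject₁ i))    ≡⟨ cong (n * toℕ j +_) (toℕ-opposite-inject₁ i) ⟩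
      n * toℕ j + suc (toℕ (opposite (suc i)))  ≡⟨ +-suc _ _ ⟩
      suc (n * toℕ j + toℕ (opposite (suc i)))  ≡⟨ +-comm _ 1 ⟨
      n * toℕ j + toℕ (opposite (suc i)) + 1    ≡⟨ cong (_+ 1) (toℕ-position (suc i) j) ⟨
      toℕ (position (suc i , j)) + 1            ∎

rotate-preserves-Γ : ∀ {n₁ m} {p q : Fin (suc n₁) × Fin (suc (suc m))} →
                     ΓAdj _ _ p q → ΓAdj _ _ (rotate p) (rotate q)
rotate-preserves-Γ {p = zero , j}  {zero , ℓ}  (inj₁ (_ , j≢ℓ)) =
  inj₁ (refl , j≢ℓ ∘ ⊕-cancelʳ (s≤s z≤n))
rotate-preserves-Γ {p = zero , j}  {zero , ℓ}  (inj₂ (inj₁ (() , _)))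
rotate-preserves-Γ {p = zero , j}  {zero , ℓ}  (inj₂ (inj₂ (() , _)))
rotate-preserves-Γ {p = zero , j}  {suc k , ℓ} (inj₁ (() , _))
rotate-preserves-Γ {p = zero , j}  {suc k , ℓ} (inj₂ (inj₁ (_ , apart))) =
  inj₂ (inj₂ (inject₁<fromℕ k , Apart-rotate j ℓ apart))
rotate-preserves-Γ {p = zero , j}  {suc k , ℓ} (inj₂ (inj₂ (() , _)))
rotate-preserves-Γ {p = suc i , j} {zero , ℓ}  (inj₁ (() , _))
rotate-preserves-Γ {p = suc i , j} {zero , ℓ}  (inj₂ (inj₁ (() , _)))
rotate-preserves-Γ {p = suc i , j} {zero , ℓ}  (inj₂ (inj₂ (_ , apart))) =
  inj₂ (inj₁ (inject₁<fromℕ i , Apart-rotate ℓ j apart))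
rotate-preserves-Γ {p = suc i , j} {suc k , ℓ} (inj₁ (i≡k , j≢ℓ)) =
  inj₁ (cong inject₁ (Fin-suc-injective i≡k) , j≢ℓ)
rotate-preserves-Γ {p = suc i , j} {suc k , ℓ} (inj₂ (inj₁ (i<k , apart))) =
  inj₂ (inj₁ (inject₁-mono-< (s<s⁻¹ i<k) , apart))
rotate-preserves-Γ {p = suc i , j} {suc k , ℓ} (inj₂ (inj₂ (k<i , apart))) =
  inj₂ (inj₂ (inject₁-mono-< (s<s⁻¹ k<i) , apart))

Γ-circulant : ∀ n₁ m → ∃[ S ] (IsConnectionSet S ×
  ∀ p q → ΓAdj (suc n₁) (suc (suc m)) p q ⇔ CayAdj S (position p) (position q))
Γ-circulant n₁ m = rotation-automorphism⇒circulant position↔ (ΓAdj _ _)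
  ΓAdj? Γ-sym Γ-irrefl rotate position-rotate rotate-preserves-Γ

proposition2p4 : (n v : ℕ) → 2 ≤ n → 2 ≤ v →
    ∃[ S ] Σ[ φ ∈ (Fin n × Fin v) ⤖ Fin (n * v) ]
      (IsConnectionSet S ×
       (∀ p q → ΓAdj n v p q ⇔ CayAdj S (Bijection.to φ p) (Bijection.to φ q)))
proposition2p4 (suc n₁) (suc (suc m)) _ _ =
  let S , S-conn , Γ⇔Cay = Γ-circulant n₁ m in S , ↔⇒⤖ position↔ , S-conn , Γ⇔Cay
proposition2p4 (suc _) (suc zero) _ (s≤s ())
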